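{- Let $G$ be an $n$-vertex graph without isolated vertices. Suppose there exist integers $1\le d\le n$ and $N\ge 0$ such that for every $1\le k<d$, $G$ contains at most $N^k$ vertices of degree $k$. Then for all $0\le p\le e^{ -1/d}$, \[\Pr[B_p(G)\in\mathrm{ZFS}(G)]\le 4pN+dnp^d.\]
   Context: All graphs are finite and simple. Zero forcing: given a graph $G$ whose vertices are each colored blue or white, if a blue vertex $u$ has exactly one white neighbor $v$, then $v$ may be recolored blue; this rule is applied repeatedly. A set $B\subseteq V(G)$ is a zero forcing set of $G$ if, starting with exactly the vertices of $B$ blue, repeated application eventually colors all of $V(G)$ blue. $\mathrm{ZFS}(G)$ is the set of zero forcing sets of $G$. For $p\in[0,1]$, $B_p(G)$ is the random subset of $V(G)$ containing each vertex independently with probability $p$.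
   Formalization: The parameter p takes only rational values in the range $0\le p\le e^{ -1/d}$. -}

module Defs where

open import Data.Bool using (Bool; true; false; _∧_; _∨_; not; if_then_else_)
open import Data.Nat as ℕ using (ℕ; zero; suc; _!)
open import Data.Nat.Properties using (_!≢0)
open import Data.Fin using (Fin; _≟_)
open import Data.List using (List; []; _∷_; map; _++_; foldr; filter; length)
open import Data.Bool.ListAction using (any; all)
open import Data.List using () renaming (allFin to allFinL)
open import Data.Integer using (+_)
open import Data.Rational using (ℚ; 0ℚ; 1ℚ; _+_; _*_; _-_; _/_)
open import Relation.Binary.PropositionalEquality using (_≡_)
open import Relation.Nullary.Decidable using (⌊_⌋)

record Graph (n : ℕ) : Set where
  field
    adj  : Fin n → Fin n → Bool
    sym  : ∀ u v → adj u v ≡ adj v u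
    irr  : ∀ v → adj v v ≡ false
open Graph public

vertices : (n : ℕ) → List (Fin n)
vertices n = allFinL n

degree : ∀ {n} → Graph n → Fin n → ℕ
degree {n} G v = length (filter (λ u → adj G v u Data.Bool.≟ true) (vertices n))

numDeg : ∀ {n} → Graph n → ℕ → ℕ
numDeg {n} G k = length (filter (λ v → degree G v ℕ.≟ k) (vertices n))

NoIsolated : ∀ {n} → Graph n → Set
NoIsolated {n} G = ∀ (v : Fin n) → 1 ℕ.≤ degree G v

-- A colouring: the set of blue vertices, as a predicate Fin n → Bool.
Colouring : ℕ → Set
Colouring n = Fin n → Bool

forceStep : ∀ {n} → Graph n → Colouring n → Colouring n
forceStep {n} G B v =
  B v ∨ any (λ u → B u ∧ adj G u v ∧
                    all (λ w → not (adj G u w) ∨ ⌊ w ≟ v ⌋ ∨ B w) (vertices n))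
            (vertices n)

iterate : ∀ {A : Set} → ℕ → (A → A) → A → A
iterate zero    f x = x
iterate (suc k) f x = f (iterate k f x)

-- Final colouring of the zero forcing process. Each round either adds a
-- vertex or reaches the (order-independent) stable final colouring, so n
-- rounds suffice.
closure : ∀ {n} → Graph n → Colouring n → Colouring n
closure {n} G B = iterate n (forceStep G) B

-- B ∈ ZFS(G) (Boolean-valued, so that probabilities can be summed)
isZFS : ∀ {n} → Graph n → Colouring n → Bool
isZFS {n} G B = all (closure G B) (vertices n)

subsets : (n : ℕ) → List (Colouring n)
subsets zero    = (λ ()) ∷ []
subsets (suc n) = map (λ B → ext false B) (subsets n) ++ map (λ B → ext true B) (subsets n)
  where
  ext : Bool → Colouring n → Colouring (suc n)
  ext b B Fin.zero    = b
  ext b B (Fin.suc i) = B i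

sumℚ : List ℚ → ℚ
sumℚ = foldr _+_ 0ℚ

prodℚ : List ℚ → ℚ
prodℚ = foldr _*_ 1ℚ

weight : ∀ {n} → ℚ → Colouring n → ℚ
weight {n} p B = prodℚ (map (λ v → if B v then p else 1ℚ - p) (vertices n))

probZFS : ∀ {n} → Graph n → ℚ → ℚ
probZFS {n} G p = sumℚ (map (λ B → if isZFS G B then weight p B else 0ℚ) (subsets n))

powℚ : ℚ → ℕ → ℚ
powℚ x zero    = 1ℚ
powℚ x (suc k) = x * powℚ x k

ℕtoℚ : ℕ → ℚ
ℕtoℚ k = (+ k) / 1

eApprox : ℕ → ℚ
eApprox zero    = 1ℚ
eApprox (suc m) = eApprox m + (+ 1) / (suc m !)
  where instance _ = suc m !≢0

-- x ≤ e⁻¹  ⇔  x · e ≤ 1  ⇔  ∀ m, x · Σ_{k ≤ m} 1/k! ≤ 1   (for x ≥ 0)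
LeInvE : ℚ → Set
LeInvE x = ∀ (m : ℕ) → x * eApprox m Data.Rational.≤ 1ℚ

{-# OPTIONS --safe #-}
module Submission where

-- If B is a zero forcing set, then either some blue vertex u forces a white neighbour v in
-- the first round, or B is already all of V(G); either way B ⊇ N[u] ∖ {v} for an edge uv.
-- That event has probability p^deg(u), so the union bound over all such pairs gives
-- Pr[B_p(G) ∈ ZFS(G)] ≤ Σ_u deg(u) p^deg(u). Grouping the vertices of degree k < d, at
-- most N^k of them, bounds their part by Σ_k k (Np)^k ≤ 4Np when Np ≤ 1/2 (for Np > 1/2
-- the claimed bound exceeds 1). Since (1 + 1/d)^d ≤ e, the hypothesis p^d ≤ 1/e forces
-- (d + 1) p ≤ d, so k p^k is non-increasing for k ≥ d and every other vertex contributes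
-- at most d p^d.

module _ where
  open import Defs hiding (sym)
  open import Algebra.Bundles using (CommutativeRing)
  open import Data.Bool using (Bool; true; false; if_then_else_; _∧_; _∨_; not; T)
  import Data.Bool as Bool
  import Data.Bool.Properties as Bool
  open import Data.Bool.ListAction using (all; any; and; or)
  open import Data.Empty using (⊥-elim)
  open import Data.Fin using (Fin; toℕ; inject₁; fromℕ) renaming (zero to fzero; suc to fsuc)
  import Data.Fin.Properties as Fin
  open import Data.Fin.Permutation using (Permutation; _⟨$⟩ʳ_; transpose)
  import Data.Integer as ℤ
  import Data.Integer.Properties as ℤ
  open import Data.List using (List; []; _∷_; map; _++_; filter; length; foldr; downFrom)
  import Data.List.Properties as List
  open import Data.List.Membership.Propositional using (_∈_; lose)
  open import Data.List.Membership.Propositional.Properties using (∈-allFin; ∈-downFrom⁻)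
  import Data.List.Relation.Unary.All as All
  open import Data.List.Relation.Unary.All.Properties using (all⁺; all⁻)
  import Data.List.Relation.Unary.Any as Any
  open import Data.List.Relation.Unary.Any using (here; there)
  open import Data.List.Relation.Unary.Any.Properties using (any⁺; any⁻)
  open import Data.Nat as ℕ using (ℕ; zero; suc; _!)
  import Data.Nat.Properties as ℕ
  import Data.Nat.DivMod as ℕ
  open import Data.Nat.Combinatorics using (_C_; _P_; nCk≡nPk/k!)
  open import Data.Nat.Combinatorics.Base using (_P′_)
  import Data.Nat.Coprimality as Coprime
  open import Data.Product using (∃; _,_)
  open import Data.Rational
  open import Data.Rational.Properties
  open import Data.Rational.Solver using (module +-*-Solver)
  open import Data.Unit using (tt)
  import Data.Vec.Functional as Vector
  open import Function using (_∘_; id)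
  open import Function.Bundles using (Equivalence)
  open import Level using (0ℓ)
  open import Relation.Binary.PropositionalEquality
  open import Relation.Nullary using (¬_; does; yes; no; contradiction)
  open import Relation.Nullary.Decidable using (T?; dec-true; dec-false)
  import Relation.Nullary.Decidable as Dec
  open import Relation.Unary using (Pred; Decidable)

  open CommutativeRing +-*-commutativeRing using (semiring; commutativeSemiring)
  open import Algebra.Properties.Semiring.Mult semiring using (_×_; ×-homo-+; ×1-homo-*; ×-assoc-*)
  open import Algebra.Properties.Semiring.Exp semiring using (_^_; ^-homo-*)
  open import Algebra.Properties.Semiring.Sum semiring
    using (sum; sum-init-last; sum-cong-≗; *-distribˡ-sum)
  open import Algebra.Properties.CommutativeSemiring.Exp commutativeSemiring using (^-distrib-*)
  import Algebra.Properties.CommutativeSemiring.Binomial commutativeSemiring as Binomial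
  import Algebra.Properties.CommutativeMonoid.Sum *-1-commutativeMonoid as Product

  ℕtoℚ≡mkℚ : ∀ k → ℕtoℚ k ≡ mkℚ (ℤ.+ k) 0 (Coprime.sym (Coprime.1-coprimeTo k))
  ℕtoℚ≡mkℚ k = normalize-coprime (Coprime.sym (Coprime.1-coprimeTo k))

  ℕtoℚ-suc : ∀ k → ℕtoℚ (suc k) ≡ 1ℚ + ℕtoℚ k
  ℕtoℚ-suc k rewrite ℕtoℚ≡mkℚ k =
    /-cong {p₁ = ℤ.+ suc k} (cong (ℤ._+_ (ℤ.+ 1)) (sym (ℤ.*-identityʳ (ℤ.+ k)))) refl

  ℕtoℚ≡×1 : ∀ k → ℕtoℚ k ≡ k × 1ℚ
  ℕtoℚ≡×1 zero    = refl
  ℕtoℚ≡×1 (suc k) = trans (ℕtoℚ-suc k) (cong (1ℚ +_) (ℕtoℚ≡×1 k))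

  ℕtoℚ-+ : ∀ a b → ℕtoℚ (a ℕ.+ b) ≡ ℕtoℚ a + ℕtoℚ b
  ℕtoℚ-+ a b rewrite ℕtoℚ≡×1 (a ℕ.+ b) | ℕtoℚ≡×1 a | ℕtoℚ≡×1 b = ×-homo-+ 1ℚ a b

  ℕtoℚ-* : ∀ a b → ℕtoℚ (a ℕ.* b) ≡ ℕtoℚ a * ℕtoℚ b
  ℕtoℚ-* a b rewrite ℕtoℚ≡×1 (a ℕ.* b) | ℕtoℚ≡×1 a | ℕtoℚ≡×1 b = ×1-homo-* a b

  ℕtoℚ-suc-* : ∀ k c → ℕtoℚ (suc k) * c ≡ c + ℕtoℚ k * c
  ℕtoℚ-suc-* k c = begin
    ℕtoℚ (suc k) * c     ≡⟨ cong (_* c) (ℕtoℚ-suc k) ⟩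
    (1ℚ + ℕtoℚ k) * c    ≡⟨ *-distribʳ-+ c 1ℚ (ℕtoℚ k) ⟩
    1ℚ * c + ℕtoℚ k * c  ≡⟨ cong (_+ ℕtoℚ k * c) (*-identityˡ c) ⟩
    c + ℕtoℚ k * c       ∎
    where open ≡-Reasoning

  ×≡ℕtoℚ* : ∀ k x → k × x ≡ ℕtoℚ k * x
  ×≡ℕtoℚ* k x = begin
    k × x         ≡⟨ cong (k ×_) (*-identityˡ x) ⟨
    k × (1ℚ * x)  ≡⟨ ×-assoc-* k 1ℚ x ⟨
    (k × 1ℚ) * x  ≡⟨ cong (_* x) (ℕtoℚ≡×1 k) ⟨
    ℕtoℚ k * x    ∎
    where open ≡-Reasoning

  powℚ≡^ : ∀ x k → powℚ x k ≡ x ^ k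
  powℚ≡^ x zero    = refl
  powℚ≡^ x (suc k) = cong (x *_) (powℚ≡^ x k)

  powℚ-+ : ∀ x j k → powℚ x (j ℕ.+ k) ≡ powℚ x j * powℚ x k
  powℚ-+ x j k rewrite powℚ≡^ x (j ℕ.+ k) | powℚ≡^ x j | powℚ≡^ x k = ^-homo-* x j k

  powℚ-distrib-* : ∀ x y k → powℚ (x * y) k ≡ powℚ x k * powℚ y k
  powℚ-distrib-* x y k rewrite powℚ≡^ (x * y) k | powℚ≡^ x k | powℚ≡^ y k = ^-distrib-* x y k

  powℚ-1 : ∀ k → powℚ 1ℚ k ≡ 1ℚ
  powℚ-1 zero    = refl
  powℚ-1 (suc k) = trans (*-identityˡ (powℚ 1ℚ k)) (powℚ-1 k)

  ℕtoℚ-^ : ∀ a k → ℕtoℚ (a ℕ.^ k) ≡ powℚ (ℕtoℚ a) k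
  ℕtoℚ-^ a zero    = refl
  ℕtoℚ-^ a (suc k) = trans (ℕtoℚ-* a (a ℕ.^ k)) (cong (ℕtoℚ a *_) (ℕtoℚ-^ a k))

  *-nonNeg : ∀ {a b} → 0ℚ ≤ a → 0ℚ ≤ b → 0ℚ ≤ a * b
  *-nonNeg {a} {b} 0≤a 0≤b =
    nonNegative⁻¹ _ {{nonNeg*nonNeg⇒nonNeg a {{nonNegative 0≤a}} b {{nonNegative 0≤b}}}}

  *-monoˡ-≤ : ∀ {r a b} → 0ℚ ≤ r → a ≤ b → r * a ≤ r * b
  *-monoˡ-≤ {r} 0≤r = *-monoˡ-≤-nonNeg r {{nonNegative 0≤r}}

  *-monoʳ-≤ : ∀ {r a b} → 0ℚ ≤ r → a ≤ b → a * r ≤ b * r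
  *-monoʳ-≤ {r} 0≤r = *-monoʳ-≤-nonNeg r {{nonNegative 0≤r}}

  *-mono-≤ : ∀ {a b c d} → 0ℚ ≤ b → 0ℚ ≤ c → a ≤ b → c ≤ d → a * c ≤ b * d
  *-mono-≤ 0≤b 0≤c a≤b c≤d = ≤-trans (*-monoʳ-≤ 0≤c a≤b) (*-monoˡ-≤ 0≤b c≤d)

  ℕtoℚ-nonNeg : ∀ k → 0ℚ ≤ ℕtoℚ k
  ℕtoℚ-nonNeg k = nonNegative⁻¹ _ {{normalize-nonNeg k 1}}

  ℕtoℚ-pos : ∀ k → 0ℚ < ℕtoℚ (suc k)
  ℕtoℚ-pos k = positive⁻¹ _ {{normalize-pos (suc k) 1}}

  ℕtoℚ-mono-≤ : ∀ {a b} → a ℕ.≤ b → ℕtoℚ a ≤ ℕtoℚ b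
  ℕtoℚ-mono-≤ {a} {b} a≤b = begin
    ℕtoℚ a                   ≡⟨ +-identityʳ (ℕtoℚ a) ⟨
    ℕtoℚ a + 0ℚ              ≤⟨ +-monoʳ-≤ (ℕtoℚ a) (ℕtoℚ-nonNeg (b ℕ.∸ a)) ⟩
    ℕtoℚ a + ℕtoℚ (b ℕ.∸ a)  ≡⟨ ℕtoℚ-+ a (b ℕ.∸ a) ⟨
    ℕtoℚ (a ℕ.+ (b ℕ.∸ a))   ≡⟨ cong ℕtoℚ (ℕ.m+[n∸m]≡n a≤b) ⟩
    ℕtoℚ b                   ∎
    where open ≤-Reasoning

  powℚ-nonNeg : ∀ {x} k → 0ℚ ≤ x → 0ℚ ≤ powℚ x k
  powℚ-nonNeg zero    _   = ℕtoℚ-nonNeg 1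
  powℚ-nonNeg (suc k) 0≤x = *-nonNeg 0≤x (powℚ-nonNeg k 0≤x)

  powℚ-pos : ∀ {x} k → 0ℚ < x → 0ℚ < powℚ x k
  powℚ-pos zero        _   = ℕtoℚ-pos 0
  powℚ-pos {x} (suc k) 0<x = positive⁻¹ _
    {{pos*pos⇒pos x {{positive 0<x}} (powℚ x k) {{positive (powℚ-pos k 0<x)}}}}

  powℚ-mono-≤ : ∀ {x y} k → 0ℚ ≤ x → x ≤ y → powℚ x k ≤ powℚ y k
  powℚ-mono-≤ zero    _   _   = ≤-refl
  powℚ-mono-≤ (suc k) 0≤x x≤y =
    *-mono-≤ (≤-trans 0≤x x≤y) (powℚ-nonNeg k 0≤x) x≤y (powℚ-mono-≤ k 0≤x x≤y)

  powℚ-mono-< : ∀ {x y} k → 0ℚ ≤ x → x < y → powℚ x (suc k) < powℚ y (suc k)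
  powℚ-mono-< {x} {y} k 0≤x x<y = ≤-<-trans
    (*-monoˡ-≤ 0≤x (powℚ-mono-≤ k 0≤x (<⇒≤ x<y)))
    (*-monoˡ-<-pos (powℚ y k) {{positive (powℚ-pos k (≤-<-trans 0≤x x<y))}} x<y)

  sum-++ : (xs ys : List ℚ) → sumℚ (xs ++ ys) ≡ sumℚ xs + sumℚ ys
  sum-++ []       ys = sym (+-identityˡ (sumℚ ys))
  sum-++ (x ∷ xs) ys = trans (cong (x +_) (sum-++ xs ys)) (sym (+-assoc x _ _))

  module _ {A : Set} where

    sum-mono-≤ : ∀ (xs : List A) {f g : A → ℚ} → (∀ {x} → x ∈ xs → f x ≤ g x) →
                 sumℚ (map f xs) ≤ sumℚ (map g xs)
    sum-mono-≤ []       f≤g = ≤-refl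
    sum-mono-≤ (x ∷ xs) f≤g = +-mono-≤ (f≤g (here refl)) (sum-mono-≤ xs (f≤g ∘ there))

    sum-+ : ∀ (xs : List A) (f g : A → ℚ) →
            sumℚ (map (λ x → f x + g x) xs) ≡ sumℚ (map f xs) + sumℚ (map g xs)
    sum-+ []       f g = refl
    sum-+ (x ∷ xs) f g = begin
      (f x + g x) + sumℚ (map (λ x → f x + g x) xs)  ≡⟨ cong ((f x + g x) +_) (sum-+ xs f g) ⟩
      (f x + g x) + (F + G)                          ≡⟨ solve 4 (λ a b F G → (a :+ b) :+ (F :+ G)
                                                                      := (a :+ F) :+ (b :+ G))
                                                              refl (f x) (g x) F G ⟩
      (f x + F) + (g x + G)                          ∎
      where
      open ≡-Reasoning
      open +-*-Solver
      F G : ℚ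
      F = sumℚ (map f xs)
      G = sumℚ (map g xs)

    sum-*ˡ : ∀ (xs : List A) c (f : A → ℚ) → sumℚ (map (λ x → c * f x) xs) ≡ c * sumℚ (map f xs)
    sum-*ˡ []       c f = sym (*-zeroʳ c)
    sum-*ˡ (x ∷ xs) c f =
      trans (cong (c * f x +_) (sum-*ˡ xs c f)) (sym (*-distribˡ-+ c (f x) _))

    sum-const : ∀ (xs : List A) c → sumℚ (map (λ _ → c) xs) ≡ ℕtoℚ (length xs) * c
    sum-const []       c = sym (*-zeroˡ c)
    sum-const (x ∷ xs) c = trans (cong (c +_) (sum-const xs c)) (sym (ℕtoℚ-suc-* (length xs) c))

    sum-indicator : ∀ {P : Pred A 0ℓ} (P? : Decidable P) (xs : List A) c →
      sumℚ (map (λ x → if does (P? x) then c else 0ℚ) xs) ≡ ℕtoℚ (length (filter P? xs)) * c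
    sum-indicator P? []       c = sym (*-zeroˡ c)
    sum-indicator P? (x ∷ xs) c with does (P? x)
    ... | false = trans (+-identityˡ _) (sum-indicator P? xs c)
    ... | true  = trans (cong (c +_) (sum-indicator P? xs c))
                        (sym (ℕtoℚ-suc-* (length (filter P? xs)) c))

    prod-indicator : ∀ {P : Pred A 0ℓ} (P? : Decidable P) (xs : List A) r →
      prodℚ (map (λ x → if does (P? x) then r else 1ℚ) xs) ≡ powℚ r (length (filter P? xs))
    prod-indicator P? []       r = refl
    prod-indicator P? (x ∷ xs) r with does (P? x)
    ... | false = trans (*-identityˡ _) (prod-indicator P? xs r)
    ... | true  = cong (r *_) (prod-indicator P? xs r)

    prod-nonNeg : ∀ (xs : List A) {f : A → ℚ} → (∀ x → 0ℚ ≤ f x) → 0ℚ ≤ prodℚ (map f xs)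
    prod-nonNeg []       0≤f = ℕtoℚ-nonNeg 1
    prod-nonNeg (x ∷ xs) 0≤f = *-nonNeg (0≤f x) (prod-nonNeg xs 0≤f)

    filter-nonEmpty : ∀ {P : Pred A 0ℓ} (P? : Decidable P) xs → 1 ℕ.≤ length (filter P? xs) → ∃ P
    filter-nonEmpty P? (x ∷ xs) 1≤len with P? x
    ... | yes px = x , px
    ... | no  _  = filter-nonEmpty P? xs 1≤len

  module _ {A B : Set} where

    sum-swap : ∀ (xs : List A) (ys : List B) (f : A → B → ℚ) →
      sumℚ (map (λ x → sumℚ (map (f x) ys)) xs) ≡ sumℚ (map (λ y → sumℚ (map (λ x → f x y) xs)) ys)
    sum-swap []       ys f = sym (trans (sum-const ys 0ℚ) (*-zeroʳ (ℕtoℚ (length ys))))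
    sum-swap (x ∷ xs) ys f =
      trans (cong (sumℚ (map (f x) ys) +_) (sum-swap xs ys f))
            (sym (sum-+ ys (f x) (λ y → sumℚ (map (λ x → f x y) xs))))

    sum-map-++ : ∀ (f : B → ℚ) (g h : A → B) (xs : List A) {f₁ f₂ : A → ℚ} →
      (∀ x → f (g x) ≡ f₁ x) → (∀ x → f (h x) ≡ f₂ x) →
      sumℚ (map f (map g xs ++ map h xs)) ≡ sumℚ (map f₁ xs) + sumℚ (map f₂ xs)
    sum-map-++ f g h xs {f₁} {f₂} f∘g≗f₁ f∘h≗f₂ = begin
      sumℚ (map f (map g xs ++ map h xs))
        ≡⟨ cong sumℚ (List.map-++ f (map g xs) (map h xs)) ⟩
      sumℚ (map f (map g xs) ++ map f (map h xs))
        ≡⟨ sum-++ (map f (map g xs)) (map f (map h xs)) ⟩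
      sumℚ (map f (map g xs)) + sumℚ (map f (map h xs))
        ≡⟨ cong₂ _+_ (sum-map-∘ g f∘g≗f₁) (sum-map-∘ h f∘h≗f₂) ⟩
      sumℚ (map f₁ xs) + sumℚ (map f₂ xs) ∎
      where
      open ≡-Reasoning
      sum-map-∘ : ∀ g {f′} → (∀ x → f (g x) ≡ f′ x) → sumℚ (map f (map g xs)) ≡ sumℚ (map f′ xs)
      sum-map-∘ g f∘g≗f′ = cong sumℚ (trans (sym (List.map-∘ xs)) (List.map-cong f∘g≗f′ xs))

  sum-downFrom-≟ : ∀ d a (g : ℕ → ℚ) →
    sumℚ (map (λ k → if does (a ℕ.≟ k) then g k else 0ℚ) (downFrom d))
      ≡ (if does (a ℕ.<? d) then g a else 0ℚ)
  sum-downFrom-≟ zero    a g = refl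
  sum-downFrom-≟ (suc d) a g with a ℕ.≟ d
  ... | yes refl
    rewrite dec-true (a ℕ.≟ a) refl | sum-downFrom-≟ a a g
          | dec-false (a ℕ.<? a) (ℕ.<-irrefl refl) | dec-true (a ℕ.<? suc a) ℕ.≤-refl
    = +-identityʳ (g a)
  ... | no a≢d rewrite dec-false (a ℕ.≟ d) a≢d | sum-downFrom-≟ d a g with a ℕ.<? d
  ...   | yes a<d
    rewrite dec-true (a ℕ.<? d) a<d | dec-true (a ℕ.<? suc d) (ℕ.m≤n⇒m≤1+n a<d)
    = +-identityˡ (g a)
  ...   | no  a≮d
    rewrite dec-false (a ℕ.<? d) a≮d
          | dec-false (a ℕ.<? suc d) (λ a<1+d → a≮d (ℕ.≤∧≢⇒< (ℕ.m<1+n⇒m≤n a<1+d) a≢d))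
    = refl

  sum-grouped-by-value : ∀ {A : Set} (xs : List A) (h : A → ℕ) d (g : ℕ → ℚ) →
    sumℚ (map (λ x → if does (h x ℕ.<? d) then g (h x) else 0ℚ) xs)
      ≡ sumℚ (map (λ k → ℕtoℚ (length (filter (λ x → h x ℕ.≟ k) xs)) * g k) (downFrom d))
  sum-grouped-by-value xs h d g = begin
    sumℚ (map (λ x → if does (h x ℕ.<? d) then g (h x) else 0ℚ) xs)
      ≡⟨ cong sumℚ (List.map-cong (λ x → sum-downFrom-≟ d (h x) g) xs) ⟨
    sumℚ (map (λ x → sumℚ (map (λ k → if does (h x ℕ.≟ k) then g k else 0ℚ) (downFrom d))) xs)
      ≡⟨ sum-swap xs (downFrom d) _ ⟩
    sumℚ (map (λ k → sumℚ (map (λ x → if does (h x ℕ.≟ k) then g k else 0ℚ) xs)) (downFrom d))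
      ≡⟨ cong sumℚ (List.map-cong (λ k → sum-indicator (λ x → h x ℕ.≟ k) xs (g k)) (downFrom d)) ⟩
    sumℚ (map (λ k → ℕtoℚ (length (filter (λ x → h x ℕ.≟ k) xs)) * g k) (downFrom d)) ∎
    where open ≡-Reasoning

  vertices-suc : ∀ {A : Set} n (g : Fin (suc n) → A) →
                 map g (vertices (suc n)) ≡ g fzero ∷ map (g ∘ fsuc) (vertices n)
  vertices-suc n g =
    trans (List.map-tabulate id g) (cong (g fzero ∷_) (sym (List.map-tabulate id (g ∘ fsuc))))

  foldr-vertices : ∀ {A B : Set} {n} (_⊕_ : A → B → B) e (f : Fin n → A) →
                   foldr _⊕_ e (map f (vertices n)) ≡ Vector.foldr _⊕_ e f
  foldr-vertices {n = zero}  _⊕_ e f = refl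
  foldr-vertices {n = suc n} _⊕_ e f = trans (cong (foldr _⊕_ e) (vertices-suc n f))
                                             (cong (f fzero ⊕_) (foldr-vertices _⊕_ e (f ∘ fsuc)))

  prod-vertices-permute : ∀ {n} (f : Fin n → ℚ) (π : Permutation n n) →
                          prodℚ (map f (vertices n)) ≡ prodℚ (map (f ∘ (π ⟨$⟩ʳ_)) (vertices n))
  prod-vertices-permute f π = begin
    prodℚ (map f (vertices _))                ≡⟨ foldr-vertices _*_ 1ℚ f ⟩
    Product.sum f                             ≡⟨ Product.sum-permute f π ⟩
    Product.sum (f ∘ (π ⟨$⟩ʳ_))               ≡⟨ foldr-vertices _*_ 1ℚ (f ∘ (π ⟨$⟩ʳ_)) ⟨
    prodℚ (map (f ∘ (π ⟨$⟩ʳ_)) (vertices _))  ∎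
    where open ≡-Reasoning

  module _ {n : ℕ} where

    all-vertices⁻ : (f : Fin n → Bool) → T (all f (vertices n)) → ∀ w → T (f w)
    all-vertices⁻ f all-f w = All.lookup (all⁺ f (vertices n) all-f) (∈-allFin w)

    all-vertices⁺ : (f : Fin n → Bool) → (∀ w → T (f w)) → T (all f (vertices n))
    all-vertices⁺ f f-holds = all⁻ f {vertices n} (All.tabulate (λ {w} _ → f-holds w))

    any-vertices⁻ : (f : Fin n → Bool) → T (any f (vertices n)) → ∃ λ w → T (f w)
    any-vertices⁻ f any-f = Any.satisfied (any⁻ f (vertices n) any-f)

    any-vertices⁺ : (f : Fin n → Bool) → ∀ w → T (f w) → T (any f (vertices n))
    any-vertices⁺ f w fw = any⁺ f (lose (∈-allFin w) fw)

  does-≟-true : ∀ b → does (b Bool.≟ true) ≡ b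
  does-≟-true true  = refl
  does-≟-true false = refl

  -- Probabilities of events for B_p

  Event : ℕ → Set
  Event n = Colouring n → Bool

  Pr : ∀ {n} → ℚ → Event n → ℚ
  Pr {n} p E = sumℚ (map (λ B → if E B then weight p B else 0ℚ) (subsets n))

  weight-suc : ∀ {n} p (B : Colouring (suc n)) →
               weight p B ≡ (if B fzero then p else 1ℚ - p) * weight p (B ∘ fsuc)
  weight-suc {n} p B = cong prodℚ (vertices-suc n (λ v → if B v then p else 1ℚ - p))

  Pr-head-independent : ∀ {n} p (t : Bool → Bool) (E : Event n) (F : Event (suc n)) →
    (∀ B → F B ≡ t (B fzero) ∧ E (B ∘ fsuc)) →
    Pr p F ≡ ((if t false then 1ℚ - p else 0ℚ) + (if t true then p else 0ℚ)) * Pr p E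
  Pr-head-independent {n} p t E F F≡ = begin
    Pr p F
      ≡⟨ sum-map-++ _ _ _ (subsets n) (λ _ → factor _) (λ _ → factor _) ⟩
    sumℚ (map (λ B → c false * term B) (subsets n)) + sumℚ (map (λ B → c true * term B) (subsets n))
      ≡⟨ cong₂ _+_ (sum-*ˡ (subsets n) (c false) term) (sum-*ˡ (subsets n) (c true) term) ⟩
    c false * Pr p E + c true * Pr p E
      ≡⟨ *-distribʳ-+ (Pr p E) (c false) (c true) ⟨
    (c false + c true) * Pr p E ∎
    where
    open ≡-Reasoning
    term : Colouring n → ℚ
    term B = if E B then weight p B else 0ℚ
    c : Bool → ℚ
    c b = if t b then (if b then p else 1ℚ - p) else 0ℚ
    factor : ∀ (B : Colouring (suc n)) →
             (if F B then weight p B else 0ℚ) ≡ c (B fzero) * term (B ∘ fsuc)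
    factor B rewrite F≡ B | weight-suc p B with t (B fzero) | E (B ∘ fsuc)
    ... | true  | true  = refl
    ... | true  | false = sym (*-zeroʳ (if B fzero then p else 1ℚ - p))
    ... | false | e     = sym (*-zeroˡ (if e then weight p (B ∘ fsuc) else 0ℚ))

  1-p+p≡1 : ∀ p → (1ℚ - p) + p ≡ 1ℚ
  1-p+p≡1 p = begin
    (1ℚ - p) + p    ≡⟨ +-assoc 1ℚ (- p) p ⟩
    1ℚ + (- p + p)  ≡⟨ cong (1ℚ +_) (+-inverseˡ p) ⟩
    1ℚ + 0ℚ         ≡⟨ +-identityʳ 1ℚ ⟩
    1ℚ              ∎
    where open ≡-Reasoning

  Pr-certain : ∀ {n} p → Pr {n} p (λ _ → true) ≡ 1ℚ
  Pr-certain {zero}  p = refl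
  Pr-certain {suc n} p = begin
    Pr {suc n} p (λ _ → true)
      ≡⟨ Pr-head-independent {n} p (λ _ → true) (λ _ → true) _ (λ _ → refl) ⟩
    ((1ℚ - p) + p) * Pr {n} p (λ _ → true)
      ≡⟨ cong₂ _*_ (1-p+p≡1 p) (Pr-certain {n} p) ⟩
    1ℚ * 1ℚ
      ≡⟨⟩
    1ℚ ∎
    where open ≡-Reasoning

  Pr-impossible : ∀ {n} p → Pr {n} p (λ _ → false) ≡ 0ℚ
  Pr-impossible {n} p = trans (sum-const (subsets n) 0ℚ) (*-zeroʳ (ℕtoℚ (length (subsets n))))

  Pr-∧ˡ : ∀ {n} p b (E : Event n) → Pr p (λ B → b ∧ E B) ≡ (if b then Pr p E else 0ℚ)
  Pr-∧ˡ     p true  E = refl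
  Pr-∧ˡ {n} p false E = Pr-impossible {n} p

  module _ {p : ℚ} (0≤p : 0ℚ ≤ p) (p≤1 : p ≤ 1ℚ) where

    weight-nonNeg : ∀ {n} (B : Colouring n) → 0ℚ ≤ weight p B
    weight-nonNeg {n} B = prod-nonNeg (vertices n) (λ v → factor-nonNeg (B v))
      where
      factor-nonNeg : ∀ b → 0ℚ ≤ (if b then p else 1ℚ - p)
      factor-nonNeg true  = 0≤p
      factor-nonNeg false = subst (_≤ 1ℚ - p) (+-inverseʳ p) (+-monoˡ-≤ (- p) p≤1)

    Pr-mono : ∀ {n} {E F : Event n} → (∀ B → T (E B) → T (F B)) → Pr p E ≤ Pr p F
    Pr-mono {n} {E} {F} E⊆F = sum-mono-≤ (subsets n) (λ {B} _ → term-mono B)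
      where
      term-mono : ∀ B → (if E B then weight p B else 0ℚ) ≤ (if F B then weight p B else 0ℚ)
      term-mono B with E B | F B | E⊆F B
      ... | true  | true  | _   = ≤-refl
      ... | true  | false | E→F = contradiction (E→F _) id
      ... | false | true  | _   = weight-nonNeg B
      ... | false | false | _   = ≤-refl

    Pr-≤1 : ∀ {n} (E : Event n) → Pr p E ≤ 1ℚ
    Pr-≤1 {n} E = ≤-trans (Pr-mono {n} {F = λ _ → true} (λ _ _ → _)) (≤-reflexive (Pr-certain {n} p))

    Pr-∨ : ∀ {n} (E F : Event n) → Pr p (λ B → E B ∨ F B) ≤ Pr p E + Pr p F
    Pr-∨ {n} E F = ≤-trans (sum-mono-≤ (subsets n) (λ {B} _ → term-∨ B))
                           (≤-reflexive (sum-+ (subsets n) (term E) (term F)))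
      where
      term : Event n → Colouring n → ℚ
      term E B = if E B then weight p B else 0ℚ
      term-∨ : ∀ B → term (λ B → E B ∨ F B) B ≤ term E B + term F B
      term-∨ B with E B | F B
      ... | true  | true  = ≤-trans (≤-reflexive (sym (+-identityʳ (weight p B))))
                                    (+-monoʳ-≤ (weight p B) (weight-nonNeg B))
      ... | true  | false = ≤-reflexive (sym (+-identityʳ _))
      ... | false | true  = ≤-reflexive (sym (+-identityˡ _))
      ... | false | false = ≤-refl

    Pr-any : ∀ {n} {A : Set} (E : A → Event n) (xs : List A) →
             Pr p (λ B → any (λ x → E x B) xs) ≤ sumℚ (map (λ x → Pr p (E x)) xs)
    Pr-any {n} E []       = ≤-reflexive (Pr-impossible {n} p)
    Pr-any {n} E (x ∷ xs) = ≤-trans (Pr-∨ (E x) (λ B → any (λ x → E x B) xs))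
                                    (+-monoʳ-≤ (Pr p (E x)) (Pr-any {n} E xs))

  _⊆ᵇ_ : ∀ {n} → Colouring n → Colouring n → Bool
  _⊆ᵇ_ {n} S B = all (λ w → not (S w) ∨ B w) (vertices n)

  ⊆ᵇ-suc : ∀ {n} (S B : Colouring (suc n)) →
           S ⊆ᵇ B ≡ (not (S fzero) ∨ B fzero) ∧ ((S ∘ fsuc) ⊆ᵇ (B ∘ fsuc))
  ⊆ᵇ-suc {n} S B = cong and (vertices-suc n (λ w → not (S w) ∨ B w))

  ⊆ᵇ⁺ : ∀ {n} {S B : Colouring n} → (∀ w → T (S w) → T (B w)) → T (S ⊆ᵇ B)
  ⊆ᵇ⁺ {S = S} {B} S⊆B = all-vertices⁺ _ (λ w → implication (S w) (B w) (S⊆B w))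
    where
    implication : ∀ s b → (T s → T b) → T (not s ∨ b)
    implication true  b s→b = s→b tt
    implication false b s→b = tt

  Pr-⊆ : ∀ {n} p (S : Colouring n) →
         Pr p (S ⊆ᵇ_) ≡ prodℚ (map (λ w → if S w then p else 1ℚ) (vertices n))
  Pr-⊆ {zero}  p S = refl
  Pr-⊆ {suc n} p S = begin
    Pr p (S ⊆ᵇ_)
      ≡⟨ Pr-head-independent p (λ b → not (S fzero) ∨ b) ((S ∘ fsuc) ⊆ᵇ_) _ (⊆ᵇ-suc S) ⟩
    (c false + c true) * Pr p ((S ∘ fsuc) ⊆ᵇ_)
      ≡⟨ cong₂ _*_ (head-factor (S fzero)) (Pr-⊆ p (S ∘ fsuc)) ⟩
    (if S fzero then p else 1ℚ) * prodℚ (map (λ w → if S (fsuc w) then p else 1ℚ) (vertices n))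
      ≡⟨ cong prodℚ (vertices-suc n (λ w → if S w then p else 1ℚ)) ⟨
    prodℚ (map (λ w → if S w then p else 1ℚ) (vertices (suc n))) ∎
    where
    open ≡-Reasoning
    c : Bool → ℚ
    c b = if not (S fzero) ∨ b then (if b then p else 1ℚ - p) else 0ℚ
    head-factor : ∀ s → (if not s ∨ false then 1ℚ - p else 0ℚ) + (if not s ∨ true then p else 0ℚ)
                      ≡ (if s then p else 1ℚ)
    head-factor true  = +-identityˡ p
    head-factor false = 1-p+p≡1 p

  -- Zero forcing

  T-not-∨-∨ : ∀ a c b → T (not a ∨ c ∨ b) → T a → ¬ T c → T b
  T-not-∨-∨ true true  b _   _ ¬c = ⊥-elim (¬c tt)
  T-not-∨-∨ true false b a→b _ _  = a→b

  T-newly-true : ∀ b x → T (not b ∧ (b ∨ x)) → T x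
  T-newly-true false x x-true = x-true

  ∨-unchanged : ∀ b x → ¬ T (not b ∧ (b ∨ x)) → b ∨ x ≡ b
  ∨-unchanged true  x     _       = refl
  ∨-unchanged false true  changed = ⊥-elim (changed tt)
  ∨-unchanged false false _       = refl

  iterate-fixed : ∀ {n} (f : Colouring n → Colouring n) (B : Colouring n) →
    (∀ {B₁ B₂} → (∀ v → B₁ v ≡ B₂ v) → ∀ v → f B₁ v ≡ f B₂ v) → (∀ v → f B v ≡ B v) →
    ∀ k v → iterate k f B v ≡ B v
  iterate-fixed f B f-cong fB≗B zero    v = refl
  iterate-fixed f B f-cong fB≗B (suc k) v =
    trans (f-cong (iterate-fixed f B f-cong fB≗B k) v) (fB≗B v)

  module _ {n : ℕ} (G : Graph n) where

    forces : Colouring n → Fin n → Fin n → Bool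
    forces B u v = B u ∧ adj G u v ∧ all (λ w → not (adj G u w) ∨ Dec.⌊ w Fin.≟ v ⌋ ∨ B w) (vertices n)

    forces-cong : ∀ {B₁ B₂ : Colouring n} → (∀ v → B₁ v ≡ B₂ v) →
                  ∀ u v → forces B₁ u v ≡ forces B₂ u v
    forces-cong B₁≗B₂ u v = cong₂ (λ b c → b ∧ adj G u v ∧ c) (B₁≗B₂ u) (cong and (List.map-cong
      (λ w → cong (λ b → not (adj G u w) ∨ Dec.⌊ w Fin.≟ v ⌋ ∨ b) (B₁≗B₂ w)) (vertices n)))

    forceStep-cong : ∀ {B₁ B₂ : Colouring n} → (∀ v → B₁ v ≡ B₂ v) →
                     ∀ v → forceStep G B₁ v ≡ forceStep G B₂ v
    forceStep-cong B₁≗B₂ v =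
      cong₂ _∨_ (B₁≗B₂ v) (cong or (List.map-cong (λ u → forces-cong B₁≗B₂ u v) (vertices n)))

    closure-fixed : ∀ B → (∀ v → ¬ T (not (B v) ∧ forceStep G B v)) → ∀ v → closure G B v ≡ B v
    closure-fixed B unchanged =
      iterate-fixed (forceStep G) B forceStep-cong (λ v → ∨-unchanged (B v) _ (unchanged v)) n

    -- For u ~ v this is N[u] ∖ {v}; composing with the transposition (u v) makes its size
    -- visibly deg u.
    N[_]∖_ : Fin n → Fin n → Colouring n
    N[ u ]∖ v = adj G u ∘ (transpose u v ⟨$⟩ʳ_)

    N[]∖-⊆ : ∀ {B : Colouring n} {u v} → T (B u) → (∀ w → T (adj G u w) → w ≢ v → T (B w)) →
             ∀ w → T ((N[ u ]∖ v) w) → T (B w)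
    N[]∖-⊆ {B} {u} {v} Bu nbrs⊆B w with w Fin.≟ u
    ... | yes refl = λ _ → Bu
    ... | no  _ with w Fin.≟ v
    ...   | yes refl = λ uu → ⊥-elim (subst T (irr G u) uu)
    ...   | no  w≢v  = λ uw → nbrs⊆B w uw w≢v

    Pr-N[]∖-⊆ : ∀ p u v → Pr p ((N[ u ]∖ v) ⊆ᵇ_) ≡ powℚ p (degree G u)
    Pr-N[]∖-⊆ p u v = begin
      Pr p ((N[ u ]∖ v) ⊆ᵇ_)
        ≡⟨ Pr-⊆ p (N[ u ]∖ v) ⟩
      prodℚ (map (λ w → if adj G u (transpose u v ⟨$⟩ʳ w) then p else 1ℚ) (vertices n))
        ≡⟨ prod-vertices-permute (λ w → if adj G u w then p else 1ℚ) (transpose u v) ⟨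
      prodℚ (map (λ w → if adj G u w then p else 1ℚ) (vertices n))
        ≡⟨ cong prodℚ (List.map-cong (λ w → cong (if_then p else 1ℚ) (sym (does-≟-true (adj G u w))))
                                     (vertices n)) ⟩
      prodℚ (map (λ w → if does (adj G u w Bool.≟ true) then p else 1ℚ) (vertices n))
        ≡⟨ prod-indicator (λ w → adj G u w Bool.≟ true) (vertices n) p ⟩
      powℚ p (degree G u) ∎
      where open ≡-Reasoning

    sum-adjacent : ∀ u c →
                   sumℚ (map (λ v → if adj G u v then c else 0ℚ) (vertices n)) ≡ ℕtoℚ (degree G u) * c
    sum-adjacent u c = trans
      (cong sumℚ (List.map-cong (λ v → cong (if_then c else 0ℚ) (sym (does-≟-true (adj G u v)))) (vertices n)))
      (sum-indicator (λ v → adj G u v Bool.≟ true) (vertices n) c)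

    containsPuncturedNbhd : Fin n → Fin n → Event n
    containsPuncturedNbhd u v B = adj G u v ∧ ((N[ u ]∖ v) ⊆ᵇ B)

    containsSomePuncturedNbhd : Event n
    containsSomePuncturedNbhd B =
      any (λ u → any (λ v → containsPuncturedNbhd u v B) (vertices n)) (vertices n)

    containsSomePuncturedNbhd⁺ : ∀ {B} u v → T (containsPuncturedNbhd u v B) →
                                 T (containsSomePuncturedNbhd B)
    containsSomePuncturedNbhd⁺ u v contains = any-vertices⁺ _ u (any-vertices⁺ _ v contains)

    forces⇒containsPuncturedNbhd : ∀ {B} u v → T (forces B u v) → T (containsPuncturedNbhd u v B)
    forces⇒containsPuncturedNbhd {B} u v u-forces-v with Equivalence.to Bool.T-∧ u-forces-v
    ... | Bu , uv∧rest with Equivalence.to Bool.T-∧ uv∧rest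
    ...   | uv , rest = Equivalence.from Bool.T-∧ (uv , ⊆ᵇ⁺ (N[]∖-⊆ Bu others-blue))
      where
      others-blue : ∀ w → T (adj G u w) → w ≢ v → T (B w)
      others-blue w uw w≢v =
        T-not-∨-∨ (adj G u w) Dec.⌊ w Fin.≟ v ⌋ (B w) (all-vertices⁻ _ rest w) uw (w≢v ∘ Dec.toWitness)

    newly-blue⇒containsSomePuncturedNbhd : ∀ B v → T (not (B v) ∧ forceStep G B v) →
                                           T (containsSomePuncturedNbhd B)
    newly-blue⇒containsSomePuncturedNbhd B v newly-blue
      with u , u-forces-v ← any-vertices⁻ _ (T-newly-true (B v) _ newly-blue)
      = containsSomePuncturedNbhd⁺ u v (forces⇒containsPuncturedNbhd u v u-forces-v)

    all-blue⇒containsSomePuncturedNbhd : Fin n → NoIsolated G → ∀ {B} → (∀ v → T (B v)) →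
                                         T (containsSomePuncturedNbhd B)
    all-blue⇒containsSomePuncturedNbhd x noIso all-blue
      with y , xy ← filter-nonEmpty (λ y → adj G x y Bool.≟ true) (vertices n) (noIso x)
      = containsSomePuncturedNbhd⁺ x y
          (Equivalence.from Bool.T-∧ (Equivalence.from Bool.T-≡ xy , ⊆ᵇ⁺ (λ w _ → all-blue w)))

    zfs⇒containsSomePuncturedNbhd : Fin n → NoIsolated G →
                                    ∀ B → T (isZFS G B) → T (containsSomePuncturedNbhd B)
    zfs⇒containsSomePuncturedNbhd x noIso B zfs with Fin.any? (λ v → T? (not (B v) ∧ forceStep G B v))
    ... | yes (v , newly-blue) = newly-blue⇒containsSomePuncturedNbhd B v newly-blue
    ... | no  none-newly-blue  = all-blue⇒containsSomePuncturedNbhd x noIso (λ v →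
            subst T (closure-fixed B (λ v changed → none-newly-blue (v , changed)) v) (all-vertices⁻ _ zfs v))

  kpᵏ : ℚ → ℕ → ℚ
  kpᵏ p k = ℕtoℚ k * powℚ p k

  probZFS≤sum-kpᵏ-degree : ∀ {n} (G : Graph n) → Fin n → NoIsolated G → ∀ {p} → 0ℚ ≤ p → p ≤ 1ℚ →
                           probZFS G p ≤ sumℚ (map (kpᵏ p ∘ degree G) (vertices n))
  probZFS≤sum-kpᵏ-degree {n} G x noIso {p} 0≤p p≤1 = begin
    probZFS G p
      ≡⟨⟩
    Pr p (isZFS G)
      ≤⟨ Pr-mono 0≤p p≤1 (zfs⇒containsSomePuncturedNbhd G x noIso) ⟩
    Pr p (containsSomePuncturedNbhd G)
      ≤⟨ Pr-any 0≤p p≤1 (λ u B → any (λ v → containsPuncturedNbhd G u v B) (vertices n)) (vertices n) ⟩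
    sumℚ (map (λ u → Pr p (λ B → any (λ v → containsPuncturedNbhd G u v B) (vertices n))) (vertices n))
      ≤⟨ sum-mono-≤ (vertices n) (λ {u} _ → Pr-any 0≤p p≤1 (containsPuncturedNbhd G u) (vertices n)) ⟩
    sumℚ (map (λ u → sumℚ (map (λ v → Pr p (containsPuncturedNbhd G u v)) (vertices n))) (vertices n))
      ≡⟨ cong sumℚ (List.map-cong (λ u → cong sumℚ (List.map-cong (Pr-containsPuncturedNbhd u) (vertices n)))
                                  (vertices n)) ⟩
    sumℚ (map (λ u → sumℚ (map (λ v → if adj G u v then powℚ p (degree G u) else 0ℚ) (vertices n)))
              (vertices n))
      ≡⟨ cong sumℚ (List.map-cong (λ u → sum-adjacent G u (powℚ p (degree G u))) (vertices n)) ⟩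
    sumℚ (map (kpᵏ p ∘ degree G) (vertices n)) ∎
    where
    open ≤-Reasoning
    Pr-containsPuncturedNbhd : ∀ u v → Pr p (containsPuncturedNbhd G u v)
                                       ≡ (if adj G u v then powℚ p (degree G u) else 0ℚ)
    Pr-containsPuncturedNbhd u v = trans (Pr-∧ˡ p (adj G u v) ((N[_]∖_ G u v) ⊆ᵇ_))
                                         (cong (if adj G u v then_else 0ℚ) (Pr-N[]∖-⊆ G p u v))

  -- (1 + 1/d)^d ≤ e

  invFact : ℕ → ℚ
  invFact k = (ℤ.+ 1 / k !) {{k ℕ.!≢0}}

  invFact-nonNeg : ∀ k → 0ℚ ≤ invFact k
  invFact-nonNeg k = nonNegative⁻¹ _ {{normalize-nonNeg 1 (k !) {{k ℕ.!≢0}}}}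

  ℕtoℚ*1/ : ∀ m .{{_ : ℕ.NonZero m}} → ℕtoℚ m * (ℤ.+ 1 / m) ≡ 1ℚ
  ℕtoℚ*1/ (suc m) = trans
    (cong₂ _*_ (ℕtoℚ≡mkℚ (suc m)) (normalize-coprime (Coprime.1-coprimeTo (suc m))))
    (*-inverseʳ (mkℚ (ℤ.+ suc m) 0 (Coprime.sym (Coprime.1-coprimeTo (suc m)))))

  ℕtoℚ-!*invFact : ∀ k → ℕtoℚ (k !) * invFact k ≡ 1ℚ
  ℕtoℚ-!*invFact k = ℕtoℚ*1/ (k !) {{k ℕ.!≢0}}

  eApprox≡sum : ∀ m → eApprox m ≡ sum {suc m} (λ k → invFact (toℕ k))
  eApprox≡sum zero    = sym (+-identityʳ 1ℚ)
  eApprox≡sum (suc m) = sym (begin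
    sum {suc (suc m)} (λ k → invFact (toℕ k))
      ≡⟨ sum-init-last {suc m} (λ k → invFact (toℕ k)) ⟩
    sum {suc m} (λ k → invFact (toℕ (inject₁ k))) + invFact (toℕ (fromℕ (suc m)))
      ≡⟨ cong₂ _+_ (sum-cong-≗ {suc m} (λ k → cong invFact (Fin.toℕ-inject₁ k)))
                   (cong invFact (Fin.toℕ-fromℕ (suc m))) ⟩
    sum {suc m} (λ k → invFact (toℕ k)) + invFact (suc m)
      ≡⟨ cong (_+ invFact (suc m)) (eApprox≡sum m) ⟨
    eApprox (suc m) ∎)
    where open ≡-Reasoning

  ∑-mono-≤ : ∀ {m} {f g : Fin m → ℚ} → (∀ i → f i ≤ g i) → sum f ≤ sum g
  ∑-mono-≤ {zero}  f≤g = ≤-refl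
  ∑-mono-≤ {suc m} f≤g = +-mono-≤ (f≤g fzero) (∑-mono-≤ (f≤g ∘ fsuc))

  nPk≤n^k : ∀ n k → n P k ℕ.≤ n ℕ.^ k
  nPk≤n^k n k with k ℕ.≤ᵇ n
  ... | true  = nP′k≤n^k k
    where
    nP′k≤n^k : ∀ k → n P′ k ℕ.≤ n ℕ.^ k
    nP′k≤n^k zero    = ℕ.≤-refl
    nP′k≤n^k (suc k) = ℕ.*-mono-≤ (ℕ.m∸n≤m n k) (nP′k≤n^k k)
  ... | false = ℕ.z≤n

  nCk*k!≤n^k : ∀ {n k} → k ℕ.≤ n → (n C k) ℕ.* k ! ℕ.≤ n ℕ.^ k
  nCk*k!≤n^k {n} {k} k≤n rewrite nCk≡nPk/k! k≤n =
    ℕ.≤-trans (ℕ.m/n*n≤m (n P k) (k !) {{k ℕ.!≢0}}) (nPk≤n^k n k)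

  binomial-term≤ : ∀ {d k} → k ℕ.≤ d →
                   ℕtoℚ (d C k) * powℚ (ℕtoℚ d) (d ℕ.∸ k) ≤ powℚ (ℕtoℚ d) d * invFact k
  binomial-term≤ {d} {k} k≤d = begin
    c * Y                                 ≡⟨ *-identityʳ (c * Y) ⟨
    c * Y * 1ℚ                            ≡⟨ cong (c * Y *_) (ℕtoℚ-!*invFact k) ⟨
    c * Y * (ℕtoℚ (k !) * invFact k)      ≡⟨ solve 4 (λ c Y f r → c :* Y :* (f :* r) := c :* f :* Y :* r)
                                                   refl c Y (ℕtoℚ (k !)) (invFact k) ⟩
    c * ℕtoℚ (k !) * Y * invFact k        ≡⟨ cong (λ z → z * Y * invFact k) (ℕtoℚ-* (d C k) (k !)) ⟨
    ℕtoℚ ((d C k) ℕ.* k !) * Y * invFact k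
      ≤⟨ *-monoʳ-≤ (invFact-nonNeg k)
           (*-monoʳ-≤ (powℚ-nonNeg (d ℕ.∸ k) (ℕtoℚ-nonNeg d)) (ℕtoℚ-mono-≤ (nCk*k!≤n^k k≤d))) ⟩
    ℕtoℚ (d ℕ.^ k) * Y * invFact k        ≡⟨ cong (λ z → z * Y * invFact k) (ℕtoℚ-^ d k) ⟩
    powℚ D k * Y * invFact k              ≡⟨ cong (_* invFact k) (powℚ-+ D k (d ℕ.∸ k)) ⟨
    powℚ D (k ℕ.+ (d ℕ.∸ k)) * invFact k  ≡⟨ cong (λ z → powℚ D z * invFact k) (ℕ.m+[n∸m]≡n k≤d) ⟩
    powℚ D d * invFact k                  ∎
    where
    open ≤-Reasoning
    open +-*-Solver
    D c Y : ℚ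
    D = ℕtoℚ d
    c = ℕtoℚ (d C k)
    Y = powℚ D (d ℕ.∸ k)

  [1+d]^d≤d^d*eApprox : ∀ d → powℚ (1ℚ + ℕtoℚ d) d ≤ powℚ (ℕtoℚ d) d * eApprox d
  [1+d]^d≤d^d*eApprox d = begin
    powℚ (1ℚ + D) d
      ≡⟨ powℚ≡^ (1ℚ + D) d ⟩
    (1ℚ + D) ^ d
      ≡⟨ Binomial.theorem d 1ℚ D ⟩
    sum {suc d} (λ k → (d C toℕ k) × (1ℚ ^ toℕ k * D ^ (d ℕ.∸ toℕ k)))
      ≡⟨ sum-cong-≗ {suc d} binomial-term ⟩
    sum {suc d} (λ k → ℕtoℚ (d C toℕ k) * powℚ D (d ℕ.∸ toℕ k))
      ≤⟨ ∑-mono-≤ {suc d} (λ k → binomial-term≤ (ℕ.m<1+n⇒m≤n (Fin.toℕ<n k))) ⟩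
    sum {suc d} (λ k → powℚ D d * invFact (toℕ k))
      ≡⟨ *-distribˡ-sum {suc d} (powℚ D d) (λ k → invFact (toℕ k)) ⟨
    powℚ D d * sum {suc d} (λ k → invFact (toℕ k))
      ≡⟨ cong (powℚ D d *_) (eApprox≡sum d) ⟨
    powℚ D d * eApprox d ∎
    where
    open ≤-Reasoning
    D : ℚ
    D = ℕtoℚ d
    binomial-term : ∀ (k : Fin (suc d)) →
      (d C toℕ k) × (1ℚ ^ toℕ k * D ^ (d ℕ.∸ toℕ k)) ≡ ℕtoℚ (d C toℕ k) * powℚ D (d ℕ.∸ toℕ k)
    binomial-term k = begin-equality
      (d C toℕ k) × (1ℚ ^ toℕ k * D ^ (d ℕ.∸ toℕ k))
        ≡⟨ ×≡ℕtoℚ* (d C toℕ k) _ ⟩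
      ℕtoℚ (d C toℕ k) * (1ℚ ^ toℕ k * D ^ (d ℕ.∸ toℕ k))
        ≡⟨ cong₂ (λ a b → ℕtoℚ (d C toℕ k) * (a * b))
                 (trans (sym (powℚ≡^ 1ℚ (toℕ k))) (powℚ-1 (toℕ k))) (sym (powℚ≡^ D (d ℕ.∸ toℕ k))) ⟩
      ℕtoℚ (d C toℕ k) * (1ℚ * powℚ D (d ℕ.∸ toℕ k))
        ≡⟨ cong (ℕtoℚ (d C toℕ k) *_) (*-identityˡ _) ⟩
      ℕtoℚ (d C toℕ k) * powℚ D (d ℕ.∸ toℕ k) ∎

  LeInvE-pow⇒[1+d]p≤d : ∀ {d p} → 1 ℕ.≤ d → 0ℚ ≤ p → LeInvE (powℚ p d) →
                        ℕtoℚ (suc d) * p ≤ ℕtoℚ d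
  LeInvE-pow⇒[1+d]p≤d {suc d′} {p} (ℕ.s≤s _) 0≤p pᵈe≤1
    with ℕtoℚ (suc (suc d′)) * p ≤? ℕtoℚ (suc d′)
  ... | yes [1+d]p≤d = [1+d]p≤d
  ... | no  [1+d]p≰d = ⊥-elim (<-irrefl refl (<-≤-trans 1<pᵈe (pᵈe≤1 d)))
    where
    open ≤-Reasoning
    d : ℕ
    d = suc d′
    D : ℚ
    D = ℕtoℚ d
    0<Dᵈ : 0ℚ < powℚ D d
    0<Dᵈ = powℚ-pos d (ℕtoℚ-pos d′)
    1<pᵈe : 1ℚ < powℚ p d * eApprox d
    1<pᵈe = *-cancelˡ-<-nonNeg (powℚ D d) {{nonNegative (<⇒≤ 0<Dᵈ)}} (begin-strict
      powℚ D d * 1ℚ                      ≡⟨ *-identityʳ (powℚ D d) ⟩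
      powℚ D d                           <⟨ powℚ-mono-< d′ (ℕtoℚ-nonNeg d) (≰⇒> [1+d]p≰d) ⟩
      powℚ (ℕtoℚ (suc d) * p) d          ≡⟨ powℚ-distrib-* (ℕtoℚ (suc d)) p d ⟩
      powℚ (ℕtoℚ (suc d)) d * powℚ p d   ≡⟨ cong (λ x → powℚ x d * powℚ p d) (ℕtoℚ-suc d) ⟩
      powℚ (1ℚ + D) d * powℚ p d         ≤⟨ *-monoʳ-≤ (powℚ-nonNeg d 0≤p) ([1+d]^d≤d^d*eApprox d) ⟩
      powℚ D d * eApprox d * powℚ p d    ≡⟨ *-assoc (powℚ D d) (eApprox d) (powℚ p d) ⟩
      powℚ D d * (eApprox d * powℚ p d)  ≡⟨ cong (powℚ D d *_) (*-comm (eApprox d) (powℚ p d)) ⟩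
      powℚ D d * (powℚ p d * eApprox d)  ∎)

  kpᵏ-nonNeg : ∀ {x} k → 0ℚ ≤ x → 0ℚ ≤ kpᵏ x k
  kpᵏ-nonNeg k 0≤x = *-nonNeg (ℕtoℚ-nonNeg k) (powℚ-nonNeg k 0≤x)

  [1+d]p≤d⇒p≤1 : ∀ {d p} → ℕtoℚ (suc d) * p ≤ ℕtoℚ d → p ≤ 1ℚ
  [1+d]p≤d⇒p≤1 {d} {p} [1+d]p≤d = *-cancelˡ-≤-pos (ℕtoℚ (suc d)) {{positive (ℕtoℚ-pos d)}} (begin
    ℕtoℚ (suc d) * p   ≤⟨ [1+d]p≤d ⟩
    ℕtoℚ d             ≤⟨ ℕtoℚ-mono-≤ (ℕ.n≤1+n d) ⟩
    ℕtoℚ (suc d)       ≡⟨ *-identityʳ (ℕtoℚ (suc d)) ⟨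
    ℕtoℚ (suc d) * 1ℚ  ∎)
    where open ≤-Reasoning

  [1+k]p≤k-beyond : ∀ {d k p} → p ≤ 1ℚ → ℕtoℚ (suc d) * p ≤ ℕtoℚ d → d ℕ.≤′ k →
                    ℕtoℚ (suc k) * p ≤ ℕtoℚ k
  [1+k]p≤k-beyond p≤1 [1+d]p≤d ℕ.≤′-refl = [1+d]p≤d
  [1+k]p≤k-beyond {k = suc k} {p} p≤1 [1+d]p≤d (ℕ.≤′-step d≤′k) = begin
    ℕtoℚ (suc (suc k)) * p  ≡⟨ ℕtoℚ-suc-* (suc k) p ⟩
    p + ℕtoℚ (suc k) * p    ≤⟨ +-mono-≤ p≤1 ([1+k]p≤k-beyond p≤1 [1+d]p≤d d≤′k) ⟩
    1ℚ + ℕtoℚ k             ≡⟨ ℕtoℚ-suc k ⟨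
    ℕtoℚ (suc k)            ∎
    where open ≤-Reasoning

  kpᵏ-antitone-beyond : ∀ {d k p} → 0ℚ ≤ p → ℕtoℚ (suc d) * p ≤ ℕtoℚ d → d ℕ.≤′ k →
                        kpᵏ p k ≤ kpᵏ p d
  kpᵏ-antitone-beyond 0≤p [1+d]p≤d ℕ.≤′-refl = ≤-refl
  kpᵏ-antitone-beyond {d} {suc k} {p} 0≤p [1+d]p≤d (ℕ.≤′-step d≤′k) = begin
    ℕtoℚ (suc k) * (p * powℚ p k)  ≡⟨ *-assoc (ℕtoℚ (suc k)) p (powℚ p k) ⟨
    ℕtoℚ (suc k) * p * powℚ p k    ≤⟨ *-monoʳ-≤ (powℚ-nonNeg k 0≤p) [1+k]p≤k ⟩
    ℕtoℚ k * powℚ p k              ≤⟨ kpᵏ-antitone-beyond 0≤p [1+d]p≤d d≤′k ⟩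
    kpᵏ p d                        ∎
    where
    open ≤-Reasoning
    [1+k]p≤k : ℕtoℚ (suc k) * p ≤ ℕtoℚ k
    [1+k]p≤k = [1+k]p≤k-beyond ([1+d]p≤d⇒p≤1 {d} [1+d]p≤d) [1+d]p≤d d≤′k

  sum-kpᵏ-½-identity : ∀ m → sumℚ (map (kpᵏ ½) (downFrom m)) + ℕtoℚ 4 * kpᵏ ½ (suc m) ≡ ℕtoℚ 2
  sum-kpᵏ-½-identity zero    = refl
  sum-kpᵏ-½-identity (suc m) = begin
    (kpᵏ ½ m + S) + ℕtoℚ 4 * (ℕtoℚ (suc (suc m)) * (½ * (½ * H)))
      ≡⟨ cong (λ k → (kpᵏ ½ m + S) + ℕtoℚ 4 * (k * (½ * (½ * H))))
              (trans (ℕtoℚ-suc (suc m)) (cong (1ℚ +_) (ℕtoℚ-suc m))) ⟩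
    (M * H + S) + ℕtoℚ 4 * ((1ℚ + (1ℚ + M)) * (½ * (½ * H)))
      ≡⟨ solve 3 (λ M H S →
             (M :* H :+ S) :+ con (ℕtoℚ 4) :* ((con 1ℚ :+ (con 1ℚ :+ M)) :* (con ½ :* (con ½ :* H)))
               := S :+ con (ℕtoℚ 4) :* ((con 1ℚ :+ M) :* (con ½ :* H)))
           refl M H S ⟩
    S + ℕtoℚ 4 * ((1ℚ + M) * (½ * H))
      ≡⟨ cong (λ k → S + ℕtoℚ 4 * (k * (½ * H))) (ℕtoℚ-suc m) ⟨
    S + ℕtoℚ 4 * kpᵏ ½ (suc m)
      ≡⟨ sum-kpᵏ-½-identity m ⟩
    ℕtoℚ 2 ∎
    where
    open ≡-Reasoning
    open +-*-Solver
    S M H : ℚ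
    S = sumℚ (map (kpᵏ ½) (downFrom m))
    M = ℕtoℚ m
    H = powℚ ½ m

  sum-kpᵏ-½≤2 : ∀ m → sumℚ (map (kpᵏ ½) (downFrom m)) ≤ ℕtoℚ 2
  sum-kpᵏ-½≤2 m = begin
    S                           ≡⟨ +-identityʳ S ⟨
    S + 0ℚ                      ≤⟨ +-monoʳ-≤ S (*-nonNeg (ℕtoℚ-nonNeg 4) (kpᵏ-nonNeg (suc m) 0≤½)) ⟩
    S + ℕtoℚ 4 * kpᵏ ½ (suc m)  ≡⟨ sum-kpᵏ-½-identity m ⟩
    ℕtoℚ 2                      ∎
    where
    open ≤-Reasoning
    S : ℚ
    S = sumℚ (map (kpᵏ ½) (downFrom m))
    0≤½ : 0ℚ ≤ ½
    0≤½ = nonNegative⁻¹ ½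

  kpᵏ≤2x*kpᵏ½ : ∀ {x} → 0ℚ ≤ x → x ≤ ½ → ∀ k → kpᵏ x k ≤ (ℕtoℚ 2 * x) * kpᵏ ½ k
  kpᵏ≤2x*kpᵏ½ {x} 0≤x x≤½ zero    = ≤-reflexive (sym (*-zeroʳ (ℕtoℚ 2 * x)))
  kpᵏ≤2x*kpᵏ½ {x} 0≤x x≤½ (suc k) = begin
    K * (x * powℚ x k)
      ≤⟨ *-monoˡ-≤ (ℕtoℚ-nonNeg (suc k)) (*-monoˡ-≤ 0≤x (powℚ-mono-≤ k 0≤x x≤½)) ⟩
    K * (x * powℚ ½ k)
      ≡⟨ solve 3 (λ K x H → K :* (x :* H) := (con (ℕtoℚ 2) :* x) :* (K :* (con ½ :* H)))
               refl K x (powℚ ½ k) ⟩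
    (ℕtoℚ 2 * x) * kpᵏ ½ (suc k) ∎
    where
    open ≤-Reasoning
    open +-*-Solver
    K : ℚ
    K = ℕtoℚ (suc k)

  sum-kpᵏ≤4x : ∀ {x} → 0ℚ ≤ x → x ≤ ½ → ∀ m → sumℚ (map (kpᵏ x) (downFrom m)) ≤ ℕtoℚ 4 * x
  sum-kpᵏ≤4x {x} 0≤x x≤½ m = begin
    sumℚ (map (kpᵏ x) (downFrom m))
      ≤⟨ sum-mono-≤ (downFrom m) (λ {k} _ → kpᵏ≤2x*kpᵏ½ 0≤x x≤½ k) ⟩
    sumℚ (map (λ k → (ℕtoℚ 2 * x) * kpᵏ ½ k) (downFrom m))
      ≡⟨ sum-*ˡ (downFrom m) (ℕtoℚ 2 * x) (kpᵏ ½) ⟩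
    (ℕtoℚ 2 * x) * sumℚ (map (kpᵏ ½) (downFrom m))
      ≤⟨ *-monoˡ-≤ (*-nonNeg (ℕtoℚ-nonNeg 2) 0≤x) (sum-kpᵏ-½≤2 m) ⟩
    (ℕtoℚ 2 * x) * ℕtoℚ 2
      ≡⟨ solve 1 (λ x → (con (ℕtoℚ 2) :* x) :* con (ℕtoℚ 2) := con (ℕtoℚ 4) :* x) refl x ⟩
    ℕtoℚ 4 * x ∎
    where
    open ≤-Reasoning
    open +-*-Solver

  split-below : ∀ d (g : ℕ → ℚ) a →
                g a ≡ (if does (a ℕ.<? d) then g a else 0ℚ) + (if does (a ℕ.<? d) then 0ℚ else g a)
  split-below d g a with does (a ℕ.<? d)
  ... | true  = sym (+-identityʳ (g a))
  ... | false = sym (+-identityˡ (g a))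

  FewLowDegrees : ∀ {n} → Graph n → ℕ → ℕ → Set
  FewLowDegrees G d N = ∀ k → 1 ℕ.≤ k → k ℕ.< d → numDeg G k ℕ.≤ N ℕ.^ k

  module _ {n : ℕ} (G : Graph n) {p : ℚ} (0≤p : 0ℚ ≤ p) where

    numDeg*kpᵏ≤ : ∀ {N k} → (1 ℕ.≤ k → numDeg G k ℕ.≤ N ℕ.^ k) →
                  ℕtoℚ (numDeg G k) * kpᵏ p k ≤ kpᵏ (ℕtoℚ N * p) k
    numDeg*kpᵏ≤ {N} {zero}  _   = ≤-reflexive (*-zeroʳ (ℕtoℚ (numDeg G 0)))
    numDeg*kpᵏ≤ {N} {suc j} few = begin
      ℕtoℚ (numDeg G k) * kpᵏ p k
        ≤⟨ *-monoʳ-≤ (kpᵏ-nonNeg k 0≤p) (ℕtoℚ-mono-≤ (few (ℕ.s≤s ℕ.z≤n))) ⟩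
      ℕtoℚ (N ℕ.^ k) * kpᵏ p k
        ≡⟨ cong (_* kpᵏ p k) (ℕtoℚ-^ N k) ⟩
      powℚ (ℕtoℚ N) k * (ℕtoℚ k * powℚ p k)
        ≡⟨ solve 3 (λ Nᵏ K pᵏ → Nᵏ :* (K :* pᵏ) := K :* (Nᵏ :* pᵏ))
                 refl (powℚ (ℕtoℚ N) k) (ℕtoℚ k) (powℚ p k) ⟩
      ℕtoℚ k * (powℚ (ℕtoℚ N) k * powℚ p k)
        ≡⟨ cong (ℕtoℚ k *_) (powℚ-distrib-* (ℕtoℚ N) p k) ⟨
      kpᵏ (ℕtoℚ N * p) k ∎
      where
      open ≤-Reasoning
      open +-*-Solver
      k : ℕ
      k = suc j

    sum-low-degrees≤4Np : ∀ {d N} → FewLowDegrees G d N → ℕtoℚ N * p ≤ ½ →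
      sumℚ (map (λ u → if does (degree G u ℕ.<? d) then kpᵏ p (degree G u) else 0ℚ) (vertices n))
        ≤ ℕtoℚ 4 * (ℕtoℚ N * p)
    sum-low-degrees≤4Np {d} {N} few Np≤½ = begin
      sumℚ (map (λ u → if does (degree G u ℕ.<? d) then kpᵏ p (degree G u) else 0ℚ) (vertices n))
        ≡⟨ sum-grouped-by-value (vertices n) (degree G) d (kpᵏ p) ⟩
      sumℚ (map (λ k → ℕtoℚ (numDeg G k) * kpᵏ p k) (downFrom d))
        ≤⟨ sum-mono-≤ (downFrom d) (λ k∈ → numDeg*kpᵏ≤ (λ 1≤k → few _ 1≤k (∈-downFrom⁻ k∈))) ⟩
      sumℚ (map (kpᵏ (ℕtoℚ N * p)) (downFrom d))
        ≤⟨ sum-kpᵏ≤4x (*-nonNeg (ℕtoℚ-nonNeg N) 0≤p) Np≤½ d ⟩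
      ℕtoℚ 4 * (ℕtoℚ N * p) ∎
      where open ≤-Reasoning

    sum-high-degrees≤nkpᵏ : ∀ {d} → ℕtoℚ (suc d) * p ≤ ℕtoℚ d →
      sumℚ (map (λ u → if does (degree G u ℕ.<? d) then 0ℚ else kpᵏ p (degree G u)) (vertices n))
        ≤ ℕtoℚ n * kpᵏ p d
    sum-high-degrees≤nkpᵏ {d} [1+d]p≤d = begin
      sumℚ (map (λ u → if does (degree G u ℕ.<? d) then 0ℚ else kpᵏ p (degree G u)) (vertices n))
        ≤⟨ sum-mono-≤ (vertices n) (λ {u} _ → high-term (degree G u)) ⟩
      sumℚ (map (λ _ → kpᵏ p d) (vertices n))
        ≡⟨ sum-const (vertices n) (kpᵏ p d) ⟩
      ℕtoℚ (length (vertices n)) * kpᵏ p d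
        ≡⟨ cong (λ m → ℕtoℚ m * kpᵏ p d) (List.length-tabulate {n = n} id) ⟩
      ℕtoℚ n * kpᵏ p d ∎
      where
      open ≤-Reasoning
      high-term : ∀ a → (if does (a ℕ.<? d) then 0ℚ else kpᵏ p a) ≤ kpᵏ p d
      high-term a with a ℕ.<? d
      ... | yes a<d rewrite dec-true (a ℕ.<? d) a<d  = kpᵏ-nonNeg d 0≤p
      ... | no  a≮d rewrite dec-false (a ℕ.<? d) a≮d =
        kpᵏ-antitone-beyond 0≤p [1+d]p≤d (ℕ.≤⇒≤′ (ℕ.≮⇒≥ a≮d))

    sum-kpᵏ-degree≤ : ∀ {d N} → FewLowDegrees G d N → ℕtoℚ (suc d) * p ≤ ℕtoℚ d → ℕtoℚ N * p ≤ ½ →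
      sumℚ (map (kpᵏ p ∘ degree G) (vertices n)) ≤ ℕtoℚ (4 ℕ.* N) * p + ℕtoℚ (d ℕ.* n) * powℚ p d
    sum-kpᵏ-degree≤ {d} {N} few [1+d]p≤d Np≤½ = begin
      sumℚ (map (kpᵏ p ∘ degree G) (vertices n))
        ≡⟨ cong sumℚ (List.map-cong (split-below d (kpᵏ p) ∘ degree G) (vertices n)) ⟩
      sumℚ (map (λ u → low u + high u) (vertices n))
        ≡⟨ sum-+ (vertices n) low high ⟩
      sumℚ (map low (vertices n)) + sumℚ (map high (vertices n))
        ≤⟨ +-mono-≤ (sum-low-degrees≤4Np few Np≤½) (sum-high-degrees≤nkpᵏ {d} [1+d]p≤d) ⟩
      ℕtoℚ 4 * (ℕtoℚ N * p) + ℕtoℚ n * (ℕtoℚ d * powℚ p d)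
        ≡⟨ solve 6 (λ a N p n d q → a :* (N :* p) :+ n :* (d :* q) := (a :* N) :* p :+ (d :* n) :* q)
                 refl (ℕtoℚ 4) (ℕtoℚ N) p (ℕtoℚ n) (ℕtoℚ d) (powℚ p d) ⟩
      (ℕtoℚ 4 * ℕtoℚ N) * p + (ℕtoℚ d * ℕtoℚ n) * powℚ p d
        ≡⟨ cong₂ (λ a b → a * p + b * powℚ p d) (ℕtoℚ-* 4 N) (ℕtoℚ-* d n) ⟨
      ℕtoℚ (4 ℕ.* N) * p + ℕtoℚ (d ℕ.* n) * powℚ p d ∎
      where
      open ≤-Reasoning
      open +-*-Solver
      low high : Fin n → ℚ
      low  u = if does (degree G u ℕ.<? d) then kpᵏ p (degree G u) else 0ℚ
      high u = if does (degree G u ℕ.<? d) then 0ℚ else kpᵏ p (degree G u)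

  1≤4Np+dnpᵈ : ∀ {d n N p} → 0ℚ ≤ p → ½ < ℕtoℚ N * p →
               1ℚ ≤ ℕtoℚ (4 ℕ.* N) * p + ℕtoℚ (d ℕ.* n) * powℚ p d
  1≤4Np+dnpᵈ {d} {n} {N} {p} 0≤p ½<Np = begin
    1ℚ                                              ≤⟨ ≤ᵇ⇒≤ _ ⟩
    ℕtoℚ 4 * ½                                      ≤⟨ *-monoˡ-≤ (ℕtoℚ-nonNeg 4) (<⇒≤ ½<Np) ⟩
    ℕtoℚ 4 * (ℕtoℚ N * p)                           ≡⟨ *-assoc (ℕtoℚ 4) (ℕtoℚ N) p ⟨
    ℕtoℚ 4 * ℕtoℚ N * p                             ≡⟨ cong (_* p) (ℕtoℚ-* 4 N) ⟨
    ℕtoℚ (4 ℕ.* N) * p                              ≡⟨ +-identityʳ _ ⟨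
    ℕtoℚ (4 ℕ.* N) * p + 0ℚ                         ≤⟨ +-monoʳ-≤ (ℕtoℚ (4 ℕ.* N) * p) dnpᵈ-nonNeg ⟩
    ℕtoℚ (4 ℕ.* N) * p + ℕtoℚ (d ℕ.* n) * powℚ p d  ∎
    where
    open ≤-Reasoning
    dnpᵈ-nonNeg : 0ℚ ≤ ℕtoℚ (d ℕ.* n) * powℚ p d
    dnpᵈ-nonNeg = *-nonNeg (ℕtoℚ-nonNeg (d ℕ.* n)) (powℚ-nonNeg d 0≤p)

open import Defs
open import Data.Nat using (ℕ; _≤_; _<_; _^_; _*_)
open import Data.Rational using (ℚ; 0ℚ) renaming (_≤_ to _≤ℚ_; _+_ to _+ℚ_; _*_ to _*ℚ_)
open import Data.Nat using (zero; suc)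
open import Data.Fin using () renaming (zero to fzero)
open import Data.Rational using (½)
open import Data.Rational.Properties using (_≤?_; ≤-trans; ≰⇒>)
open import Relation.Nullary using (yes; no)

theorem3p3 : (n : ℕ) (G : Graph n) → NoIsolated G →
    (d N : ℕ) → 1 ≤ d → d ≤ n →
    (∀ (k : ℕ) → 1 ≤ k → k < d → numDeg G k ≤ N ^ k) →
    (p : ℚ) → 0ℚ ≤ℚ p → LeInvE (powℚ p d) →
    probZFS G p ≤ℚ (ℕtoℚ (4 * N) *ℚ p) +ℚ (ℕtoℚ (d * n) *ℚ powℚ p d)
theorem3p3 zero    _ _ zero    _ () _
theorem3p3 zero    _ _ (suc _) _ _  ()
-- d ≤ n is only needed to exclude the empty graph, whose empty set is zero forcing.
theorem3p3 (suc n) G noIso d N 1≤d _ few p 0≤p pᵈe≤1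
  with [1+d]p≤d ← LeInvE-pow⇒[1+d]p≤d 1≤d 0≤p pᵈe≤1
  with p≤1 ← [1+d]p≤d⇒p≤1 {d} [1+d]p≤d
  with ℕtoℚ N *ℚ p ≤? ½
... | yes Np≤½ = ≤-trans (probZFS≤sum-kpᵏ-degree G fzero noIso 0≤p p≤1)
                         (sum-kpᵏ-degree≤ G 0≤p few [1+d]p≤d Np≤½)
... | no  Np≰½ = ≤-trans (Pr-≤1 0≤p p≤1 (isZFS G)) (1≤4Np+dnpᵈ {d} {suc n} {N} 0≤p (≰⇒> Np≰½))
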